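{- For every integer $n>1$, the number $22\times(10^{n}-1)$ equals $2B$ for some Ball magic number $B$.
   Context: Ball magic number: let $N\ge 2$ and let $x$ be a positive integer with exactly $N$ decimal digits, $x=a_{N-1}\dots a_0$ with $a_{N-1}\neq 0$, which is not a palindrome. Its reverse $x'$ is the integer with digit string $a_0a_1\dots a_{N-1}$ (leading zeros allowed). Let $y=|x-x'|$, written as an $N$-digit string $b_{N-1}\dots b_0$ (leading zeros allowed), and let $y'$ be the integer with digit string $b_0\dots b_{N-1}$. The nonzero integer $B=y+y'$ is a Ball magic number; a Ball magic number is any integer obtained this way from some such $x$. -}

module Defs where

open import Data.Nat using (ℕ; zero; suc; _+_; _*_; _^_; _∸_; _≤_; _<_; _≥_)
open import Data.Nat.DivMod using (_/_; _%_)
open import Data.Nat.Base using (∣_-_∣)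
open import Data.Vec using (Vec; []; _∷_; reverse)
open import Data.Product using (∃; _×_; _,_)
open import Relation.Binary.PropositionalEquality using (_≡_; _≢_)

digits : (N : ℕ) → ℕ → Vec ℕ N
digits zero    m = []
digits (suc N) m = m % 10 ∷ digits N (m / 10)

value : ∀ {N} → Vec ℕ N → ℕ
value []       = 0
value (d ∷ ds) = d + 10 * value ds

-- Reverse of m viewed as an N-digit string (leading zeros allowed).
rev : (N : ℕ) → ℕ → ℕ
rev N m = value (reverse (digits N m))

ballOf : (N : ℕ) → ℕ → ℕ
ballOf N x = let y = ∣ x - rev N x ∣ in y + rev N y

IsBallMagic : ℕ → Set
IsBallMagic B =
  ∃ λ N → ∃ λ x →
    2 ≤ N × 10 ^ (N ∸ 1) ≤ x × x < 10 ^ N × x ≢ rev N x × B ≡ ballOf N x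

-- Take x = 10ⁿ, written with N = n + 1 digits as 10…0.  Its reverse is 1, so
-- y = 10ⁿ − 1 = 99…9 (n nines, padded with a leading zero), whose reverse is
-- 99…90 = 10 y.  Hence B = y + 10 y = 11 (10ⁿ − 1), and 2B = 22 (10ⁿ − 1).
module Submission where

open import Defs
open import Data.Nat using (ℕ; _*_; _∸_; _^_; _<_)
open import Data.Product using (∃; _×_)
open import Relation.Binary.PropositionalEquality using (_≡_)

open import Data.Nat using (zero; suc; _+_; _≤_; s≤s; z≤n; s<s; z<s)
open import Data.Nat.Base using (∣_-_∣)
open import Data.Nat.Properties
open import Data.Nat.DivMod using (_%_; _/_; [m+kn]%n≡m%n; m<n⇒m%n≡m; m<n⇒m/n≡0; +-distrib-/-∣ʳ; m*n/n≡m)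
open import Data.Nat.Divisibility using (m∣m*n)
open import Data.Vec using (Vec; []; _∷_; reverse; replicate; _∷ʳ_)
open import Data.Vec.Properties using (reverse-∷; reverse-involutive)
open import Data.Vec.Relation.Unary.All using (All; []; _∷_)
open import Data.Product using (_,_)
open import Data.Sum using (inj₁; inj₂)
open import Relation.Binary.PropositionalEquality using (_≢_; refl; sym; trans; cong; cong₂; module ≡-Reasoning)
open ≡-Reasoning

Digits : ∀ {N} → Vec ℕ N → Set
Digits = All (_< 10)

replicate-digits : ∀ n {d} → d < 10 → Digits (replicate n d)
replicate-digits zero    d<10 = []
replicate-digits (suc n) d<10 = d<10 ∷ replicate-digits n d<10

∷ʳ-digits : ∀ {n d} {ds : Vec ℕ n} → Digits ds → d < 10 → Digits (ds ∷ʳ d)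
∷ʳ-digits []             d<10 = d<10 ∷ []
∷ʳ-digits (e<10 ∷ ds<10) d<10 = e<10 ∷ ∷ʳ-digits ds<10 d<10

[d+10m]%10≡d : ∀ {d} m → d < 10 → (d + 10 * m) % 10 ≡ d
[d+10m]%10≡d {d} m d<10 = begin
  (d + 10 * m) % 10 ≡⟨ cong (λ t → (d + t) % 10) (*-comm 10 m) ⟩
  (d + m * 10) % 10 ≡⟨ [m+kn]%n≡m%n d m 10 ⟩
  d % 10            ≡⟨ m<n⇒m%n≡m d<10 ⟩
  d                 ∎

[d+10m]/10≡m : ∀ {d} m → d < 10 → (d + 10 * m) / 10 ≡ m
[d+10m]/10≡m {d} m d<10 = begin
  (d + 10 * m) / 10    ≡⟨ +-distrib-/-∣ʳ d (m∣m*n m) ⟩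
  d / 10 + 10 * m / 10 ≡⟨ cong₂ _+_ (m<n⇒m/n≡0 d<10) (cong (_/ 10) (*-comm 10 m)) ⟩
  m * 10 / 10          ≡⟨ m*n/n≡m m 10 ⟩
  m                    ∎

digits-value : ∀ {N} {ds : Vec ℕ N} → Digits ds → digits N (value ds) ≡ ds
digits-value []                           = refl
digits-value {ds = d ∷ ds} (d<10 ∷ ds<10) = cong₂ _∷_
  ([d+10m]%10≡d (value ds) d<10)
  (trans (cong (digits _) ([d+10m]/10≡m (value ds) d<10)) (digits-value ds<10))

rev-value : ∀ {N} {ds : Vec ℕ N} → Digits ds → rev N (value ds) ≡ value (reverse ds)
rev-value ds<10 = cong (λ es → value (reverse es)) (digits-value ds<10)

value-∷ʳ : ∀ {n} (ds : Vec ℕ n) d → value (ds ∷ʳ d) ≡ value ds + 10 ^ n * d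
value-∷ʳ         []       d = trans (+-identityʳ d) (sym (+-identityʳ d))
value-∷ʳ {suc n} (e ∷ ds) d = begin
  e + 10 * value (ds ∷ʳ d)                ≡⟨ cong (λ t → e + 10 * t) (value-∷ʳ ds d) ⟩
  e + 10 * (value ds + 10 ^ n * d)        ≡⟨ cong (e +_) (*-distribˡ-+ 10 (value ds) (10 ^ n * d)) ⟩
  e + (10 * value ds + 10 * (10 ^ n * d)) ≡⟨ sym (+-assoc e (10 * value ds) _) ⟩
  e + 10 * value ds + 10 * (10 ^ n * d)   ≡⟨ cong (e + 10 * value ds +_) (sym (*-assoc 10 (10 ^ n) d)) ⟩
  e + 10 * value ds + 10 ^ suc n * d      ∎

reverse-replicate : ∀ {A : Set} n (a : A) → reverse (replicate n a) ≡ replicate n a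
reverse-replicate zero    a = refl
reverse-replicate (suc n) a = begin
  reverse (a ∷ replicate n a)  ≡⟨ reverse-∷ a (replicate n a) ⟩
  reverse (replicate n a) ∷ʳ a ≡⟨ cong (_∷ʳ a) (reverse-replicate n a) ⟩
  replicate n a ∷ʳ a           ≡⟨ replicate-∷ʳ n ⟩
  a ∷ replicate n a            ∎
  where
  replicate-∷ʳ : ∀ n → replicate n a ∷ʳ a ≡ a ∷ replicate n a
  replicate-∷ʳ zero    = refl
  replicate-∷ʳ (suc n) = cong (a ∷_) (replicate-∷ʳ n)

reverse-replicate-∷ʳ : ∀ {A : Set} n (a b : A) → reverse (replicate n a ∷ʳ b) ≡ b ∷ replicate n a
reverse-replicate-∷ʳ n a b = begin
  reverse (replicate n a ∷ʳ b)           ≡⟨ cong (λ as → reverse (as ∷ʳ b)) (sym (reverse-replicate n a)) ⟩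
  reverse (reverse (replicate n a) ∷ʳ b) ≡⟨ cong reverse (sym (reverse-∷ b (replicate n a))) ⟩
  reverse (reverse (b ∷ replicate n a))  ≡⟨ reverse-involutive (b ∷ replicate n a) ⟩
  b ∷ replicate n a                      ∎

value-replicate-0 : ∀ n → value (replicate n 0) ≡ 0
value-replicate-0 zero    = refl
value-replicate-0 (suc n) = cong (10 *_) (value-replicate-0 n)

1+value-replicate-9 : ∀ n → 1 + value (replicate n 9) ≡ 10 ^ n
1+value-replicate-9 zero    = refl
1+value-replicate-9 (suc n) = begin
  10 + 10 * value (replicate n 9) ≡⟨ sym (*-distribˡ-+ 10 1 _) ⟩
  10 * (1 + value (replicate n 9)) ≡⟨ cong (10 *_) (1+value-replicate-9 n) ⟩
  10 * 10 ^ n                      ∎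

rev-10^ : ∀ n → rev (suc n) (10 ^ n) ≡ 1
rev-10^ n = begin
  rev (suc n) (10 ^ n)                     ≡⟨ cong (rev (suc n)) 10^n≡value ⟩
  rev (suc n) (value (replicate n 0 ∷ʳ 1)) ≡⟨ rev-value (∷ʳ-digits (replicate-digits n z<s) (s<s z<s)) ⟩
  value (reverse (replicate n 0 ∷ʳ 1))     ≡⟨ cong value (reverse-replicate-∷ʳ n 0 1) ⟩
  1 + 10 * value (replicate n 0)           ≡⟨ cong (λ t → 1 + 10 * t) (value-replicate-0 n) ⟩
  1                                        ∎
  where
  10^n≡value : 10 ^ n ≡ value (replicate n 0 ∷ʳ 1)
  10^n≡value = sym (trans (value-∷ʳ (replicate n 0) 1)
                          (cong₂ _+_ (value-replicate-0 n) (*-identityʳ (10 ^ n))))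

rev-nines : ∀ n → rev (suc n) (value (replicate n 9)) ≡ 10 * value (replicate n 9)
rev-nines n = begin
  rev (suc n) (value (replicate n 9))      ≡⟨ cong (rev (suc n)) nines≡value ⟩
  rev (suc n) (value (replicate n 9 ∷ʳ 0)) ≡⟨ rev-value (∷ʳ-digits (replicate-digits n (n<1+n 9)) z<s) ⟩
  value (reverse (replicate n 9 ∷ʳ 0))     ≡⟨ cong value (reverse-replicate-∷ʳ n 9 0) ⟩
  10 * value (replicate n 9)               ∎
  where
  nines≡value : value (replicate n 9) ≡ value (replicate n 9 ∷ʳ 0)
  nines≡value = sym (trans (value-∷ʳ (replicate n 9) 0)
                           (trans (cong (value (replicate n 9) +_) (*-zeroʳ (10 ^ n)))
                                  (+-identityʳ _)))

ballOf-10^ : ∀ n → ballOf (suc n) (10 ^ n) ≡ 11 * (10 ^ n ∸ 1)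
ballOf-10^ n = begin
  ∣ 10 ^ n - rev (suc n) (10 ^ n) ∣ + rev (suc n) ∣ 10 ^ n - rev (suc n) (10 ^ n) ∣
    ≡⟨ cong (λ r → ∣ 10 ^ n - r ∣ + rev (suc n) ∣ 10 ^ n - r ∣) (rev-10^ n) ⟩
  ∣ 10 ^ n - 1 ∣ + rev (suc n) ∣ 10 ^ n - 1 ∣
    ≡⟨ cong (λ y → y + rev (suc n) y) ∣10^n-1∣≡nines ⟩
  nines + rev (suc n) nines  ≡⟨ cong (nines +_) (rev-nines n) ⟩
  11 * nines                 ≡⟨ cong (λ x → 11 * (x ∸ 1)) (1+value-replicate-9 n) ⟩
  11 * (10 ^ n ∸ 1)          ∎
  where
  nines = value (replicate n 9)
  ∣10^n-1∣≡nines : ∣ 10 ^ n - 1 ∣ ≡ nines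
  ∣10^n-1∣≡nines = trans (cong (∣_- 1 ∣) (sym (1+value-replicate-9 n))) (m≤n⇒∣n-m∣≡n∸m (s≤s z≤n))

isBallMagic-11*[10^n∸1] : ∀ n → 1 ≤ n → IsBallMagic (11 * (10 ^ n ∸ 1))
isBallMagic-11*[10^n∸1] n@(suc _) 1≤n =
  suc n , 10 ^ n , s≤s 1≤n , ≤-refl , ^-monoʳ-< 10 (s≤s (s≤s z≤n)) (n<1+n n) ,
  not-palindrome , sym (ballOf-10^ n)
  where
  not-palindrome : 10 ^ n ≢ rev (suc n) (10 ^ n)
  not-palindrome eq with m^n≡1⇒n≡0∨m≡1 10 n (trans eq (rev-10^ n))
  ... | inj₁ ()
  ... | inj₂ ()

corollary6 : (n : ℕ) → 1 < n → ∃ λ B → IsBallMagic B × 22 * (10 ^ n ∸ 1) ≡ 2 * B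
corollary6 n 1<n = 11 * (10 ^ n ∸ 1) , isBallMagic-11*[10^n∸1] n (<⇒≤ 1<n) , *-assoc 2 11 (10 ^ n ∸ 1)
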